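{- Let $r>0$ be real and $n\geq0$ an integer. Then for every complex $y$, \[ w_{n}^{(r)}(y)=\sum_{k=0}^{n}\left\{{n+r\atop k+r}\right\}_{r}(r)_{k}(-1)^{n+k}(y+1)^{k}. \] In particular \[ w_{n}^{(r)}(1)=\sum_{k=0}^{n}\left\{{n+r\atop k+r}\right\}_{r}(r)_{k}(-1)^{n+k}2^{k}. \]
   Context: For real $r>0$ and integer $n\ge0$, $w_{n}^{(r)}(y)=\sum_{k=0}^{n}\left\{{n\atop k}\right\}(r)_{k}\,y^{k}$, where $\left\{{n\atop k}\right\}$ are Stirling numbers of the second kind and $(x)_{k}=x(x+1)\cdots(x+k-1)$, $(x)_0=1$. The $r$-Stirling numbers of the second kind $\left\{{n+r\atop k+r}\right\}_{r}$ (for integers $n,k\ge0$) are defined by $\frac{(e^{t}-1)^{k}e^{rt}}{k!}=\sum_{n\geq k}\left\{{n+r\atop k+r}\right\}_{r}\frac{t^{n}}{n!}$, and are $0$ for $k>n$. -}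

module Defs where

open import Level using (Level)
open import Data.Nat as ℕ using (ℕ; zero; suc)
open import Data.Nat.Combinatorics using (_C_)
open import Algebra.Bundles using (CommutativeRing)

S2 : ℕ → ℕ → ℕ
S2 zero    zero    = 1
S2 zero    (suc k) = 0
S2 (suc n) zero    = 0
S2 (suc n) (suc k) = S2 n k ℕ.+ suc k ℕ.* S2 n (suc k)

module _ {c ℓ : Level} (R : CommutativeRing c ℓ) where
  open CommutativeRing R

  ι : ℕ → Carrier
  ι zero    = 0#
  ι (suc n) = 1# + ι n

  pow : Carrier → ℕ → Carrier
  pow x zero    = 1#
  pow x (suc k) = x * pow x k

  rising : Carrier → ℕ → Carrier
  rising x zero    = 1#
  rising x (suc k) = rising x k * (x + ι k)

  sumTo : ℕ → (ℕ → Carrier) → Carrier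
  sumTo zero    f = f 0
  sumTo (suc n) f = sumTo n f + f (suc n)

  w : Carrier → ℕ → Carrier → Carrier
  w r n y = sumTo n (λ k → ι (S2 n k) * (rising r k * pow y k))

  -- r-Stirling numbers {n+r, k+r}_r : coefficient of t^n/n! in
  -- e^{rt} (e^t-1)^k / k!  =  (Σ_m r^m t^m/m!) (Σ_j {j k} t^j/j!),
  -- i.e. Σ_{j=0}^{n} C(n,j) {j k} r^{n-j}.
  rS2 : Carrier → ℕ → ℕ → Carrier
  rS2 r n k = sumTo n (λ j → ι (n C j) * (ι (S2 j k) * pow r (n ℕ.∸ j)))

-- Put coeff n k = (-1)^(n+k) {n+r, k+r}_r (r)_k. Expanding (y+1)^k binomially, the theorem says
-- Σ_k coeff n k C(k,m) = {n m} (r)_m for every m. The r-Stirling numbers are the binomial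
-- convolution of {j k} with the powers of r, whence {n+1+r, k+r}_r = {n+r, k-1+r}_r + (k+r) {n+r, k+r}_r,
-- so coeff (n+1) k = u (k-1) - u k with u k = (r+k) coeff n k. Summation by parts then turns
-- Σ_k coeff (n+1) k C(k,m) into Σ_k (r+k) coeff n k C(k,m-1), and k C(k,m-1) = m C(k,m) + (m-1) C(k,m-1)
-- shows that both sides of the identity obey the recurrence of {n m} (r)_m.
module Submission where

open import Defs
open import Level using (Level)
open import Data.Nat using (ℕ; _+_)
open import Data.Product using (_×_)
open import Algebra.Bundles using (CommutativeRing)

open import Data.Nat as ℕ using (zero; suc; _∸_; _≤_; _<_; z≤n; s≤s)
import Data.Nat.Properties as ℕₚ
open import Data.Nat.Combinatorics using (_C_; k>n⇒nCk≡0; nCk+nC[k+1]≡[n+1]C[k+1]; nC1≡n)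
open import Data.Nat.Tactic.RingSolver using (solve-∀)
open import Data.Product using (_,_)
open import Data.Sum using (inj₁; inj₂)
open import Function using (_∘_)
open import Relation.Binary.PropositionalEquality as ≡ using (_≡_; cong; cong₂)

S2-vanishes : ∀ {j k} → j < k → S2 j k ≡ 0
S2-vanishes {zero}  {suc k} _ = ≡.refl
S2-vanishes {suc j} {suc k} (s≤s j<k)
  rewrite S2-vanishes j<k | S2-vanishes (ℕₚ.m<n⇒m<1+n j<k) = ℕₚ.*-zeroʳ (suc k)

n*nCk≡[1+k]*nC[1+k]+k*nCk : ∀ n k → n ℕ.* (n C k) ≡ suc k ℕ.* (n C suc k) + k ℕ.* (n C k)
n*nCk≡[1+k]*nC[1+k]+k*nCk zero    zero    = ≡.refl
n*nCk≡[1+k]*nC[1+k]+k*nCk zero    (suc k) =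
  ≡.sym (cong₂ _+_ (ℕₚ.*-zeroʳ (suc (suc k))) (ℕₚ.*-zeroʳ (suc k)))
n*nCk≡[1+k]*nC[1+k]+k*nCk (suc n) zero    rewrite nC1≡n (suc n) = unit (suc n)
  where
  unit : ∀ m → m ℕ.* 1 ≡ 1 ℕ.* m + 0 ℕ.* 1
  unit = solve-∀
n*nCk≡[1+k]*nC[1+k]+k*nCk (suc n) (suc k) = begin
  suc n ℕ.* (suc n C suc k)
    ≡⟨ cong (suc n ℕ.*_) (nCk+nC[k+1]≡[n+1]C[k+1] n k) ⟨
  suc n ℕ.* (a + b)
    ≡⟨ distribute n a b ⟩
  (n ℕ.* a + a) + (n ℕ.* b + b)
    ≡⟨ cong₂ (λ x y → (x + a) + (y + b))
             (n*nCk≡[1+k]*nC[1+k]+k*nCk n k) (n*nCk≡[1+k]*nC[1+k]+k*nCk n (suc k)) ⟩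
  ((suc k ℕ.* b + k ℕ.* a) + a) + ((suc (suc k) ℕ.* c + suc k ℕ.* b) + b)
    ≡⟨ regroup k a b c ⟩
  suc (suc k) ℕ.* (b + c) + suc k ℕ.* (a + b)
    ≡⟨ cong₂ (λ x y → suc (suc k) ℕ.* x + suc k ℕ.* y)
             (nCk+nC[k+1]≡[n+1]C[k+1] n (suc k)) (nCk+nC[k+1]≡[n+1]C[k+1] n k) ⟩
  suc (suc k) ℕ.* (suc n C suc (suc k)) + suc k ℕ.* (suc n C suc k) ∎
  where
  open ≡.≡-Reasoning
  a = n C k
  b = n C suc k
  c = n C suc (suc k)
  distribute : ∀ n a b → suc n ℕ.* (a + b) ≡ (n ℕ.* a + a) + (n ℕ.* b + b)
  distribute = solve-∀
  regroup : ∀ k a b c → ((suc k ℕ.* b + k ℕ.* a) + a) + ((suc (suc k) ℕ.* c + suc k ℕ.* b) + b)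
                      ≡ suc (suc k) ℕ.* (b + c) + suc k ℕ.* (a + b)
  regroup = solve-∀

module _ {ℓ₁ ℓ₂ : Level} (R : CommutativeRing ℓ₁ ℓ₂) where

  open CommutativeRing R hiding (zero) renaming (_+_ to _⊕_)
  open import Algebra.Properties.Ring ring
    using (-1*x≈-x; -‿distribˡ-*; -‿distribʳ-*; x[y-z]≈xy-xz; [y-z]x≈yx-zx)
  open import Algebra.Properties.AbelianGroup +-abelianGroup using (xyx⁻¹≈y)
  open import Algebra.Properties.Group +-group
    using () renaming (ε⁻¹≈ε to -0#≈0#; ⁻¹-involutive to -‿involutive)
  open import Algebra.Properties.CommutativeSemigroup +-commutativeSemigroup
    using (interchange) renaming (x∙yz≈y∙xz to x+[y+z]≈y+[x+z])
  open import Algebra.Properties.CommutativeSemigroup *-commutativeSemigroup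
    using () renaming (x∙yz≈y∙xz to x*[y*z]≈y*[x*z])
  open import Algebra.Properties.Semiring.Mult semiring
    using (×-homo-+; ×1-homo-*) renaming (_×_ to _·_)
  open import Relation.Binary.Reasoning.Setoid setoid
  open import Algebra.Solver.Ring.NaturalCoefficients.Default commutativeSemiring
    using (solve; _:=_; _:+_; _:*_; con)

  ∑ : ℕ → (ℕ → Carrier) → Carrier
  ∑ = sumTo R

  infix 6.5 ∑
  syntax ∑ n (λ k → f) = ∑[ k ≤ n ] f

  ∑-cong : ∀ n {f g : ℕ → Carrier} → (∀ {k} → k ≤ n → f k ≈ g k) → ∑ n f ≈ ∑ n g
  ∑-cong zero    f≈g = f≈g z≤n
  ∑-cong (suc n) f≈g = +-cong (∑-cong n (f≈g ∘ ℕₚ.m≤n⇒m≤1+n)) (f≈g ℕₚ.≤-refl)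

  ∑-zero : ∀ n {f : ℕ → Carrier} → (∀ {k} → k ≤ n → f k ≈ 0#) → ∑ n f ≈ 0#
  ∑-zero zero    f≈0 = f≈0 z≤n
  ∑-zero (suc n) f≈0 = trans (+-cong (∑-zero n (f≈0 ∘ ℕₚ.m≤n⇒m≤1+n)) (f≈0 ℕₚ.≤-refl)) (+-identityʳ 0#)

  ∑-distrib-⊕ : ∀ n (f g : ℕ → Carrier) → ∑[ k ≤ n ] (f k ⊕ g k) ≈ ∑ n f ⊕ ∑ n g
  ∑-distrib-⊕ zero    f g = refl
  ∑-distrib-⊕ (suc n) f g = trans (+-congʳ (∑-distrib-⊕ n f g)) (interchange _ _ _ _)

  *-distribˡ-∑ : ∀ n a (f : ℕ → Carrier) → a * ∑ n f ≈ ∑[ k ≤ n ] a * f k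
  *-distribˡ-∑ zero    a f = refl
  *-distribˡ-∑ (suc n) a f = trans (distribˡ a _ _) (+-congʳ (*-distribˡ-∑ n a f))

  *-distribʳ-∑ : ∀ n a (f : ℕ → Carrier) → ∑ n f * a ≈ ∑[ k ≤ n ] f k * a
  *-distribʳ-∑ zero    a f = refl
  *-distribʳ-∑ (suc n) a f = trans (distribʳ a _ _) (+-congʳ (*-distribʳ-∑ n a f))

  ∑-suc : ∀ n (f : ℕ → Carrier) → ∑ (suc n) f ≈ f 0 ⊕ ∑[ k ≤ n ] f (suc k)
  ∑-suc zero    f = refl
  ∑-suc (suc n) f = trans (+-congʳ (∑-suc n f)) (+-assoc _ _ _)

  ∑-pad : ∀ {n N} (f : ℕ → Carrier) → n ≤ N → (∀ {k} → n < k → f k ≈ 0#) → ∑ N f ≈ ∑ n f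
  ∑-pad {N = zero}  f z≤n   _   = refl
  ∑-pad {N = suc N} f n≤1+N f≈0 with ℕₚ.m≤n⇒m<n∨m≡n n≤1+N
  ... | inj₂ ≡.refl    = refl
  ... | inj₁ (s≤s n≤N) = trans (+-cong (∑-pad f n≤N f≈0) (f≈0 (s≤s n≤N))) (+-identityʳ _)

  ∑-comm : ∀ n m (f : ℕ → ℕ → Carrier) → ∑[ i ≤ n ] ∑[ j ≤ m ] f i j ≈ ∑[ j ≤ m ] ∑[ i ≤ n ] f i j
  ∑-comm zero    m f = refl
  ∑-comm (suc n) m f = trans (+-congʳ (∑-comm n m f)) (sym (∑-distrib-⊕ m _ _))

  ∇ : (ℕ → Carrier) → ℕ → Carrier
  ∇ u zero    = - u zero
  ∇ u (suc k) = u k - u (suc k)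

  ∑-∇-by-parts : ∀ n (u g : ℕ → Carrier) →
                 ∑[ k ≤ suc n ] ∇ u k * g k ≈ ∑[ k ≤ n ] u k * (g (suc k) - g k) - u (suc n) * g (suc n)
  ∑-∇-by-parts zero    u g = begin
    - u 0 * g 0 ⊕ (u 0 - u 1) * g 1
      ≈⟨ +-cong (sym (-‿distribˡ-* (u 0) (g 0))) ([y-z]x≈yx-zx (g 1) (u 0) (u 1)) ⟩
    - (u 0 * g 0) ⊕ (u 0 * g 1 - u 1 * g 1)
      ≈⟨ solve 3 (λ a b c → a :+ (b :+ c) := (b :+ a) :+ c) refl _ _ _ ⟩
    (u 0 * g 1 - u 0 * g 0) - u 1 * g 1
      ≈⟨ +-congʳ (x[y-z]≈xy-xz (u 0) (g 1) (g 0)) ⟨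
    u 0 * (g 1 - g 0) - u 1 * g 1 ∎
  ∑-∇-by-parts (suc n) u g = begin
    ∑[ k ≤ suc n ] ∇ u k * g k ⊕ (u (1 + n) - u (2 + n)) * g (2 + n)
      ≈⟨ +-cong (∑-∇-by-parts n u g) ([y-z]x≈yx-zx (g (2 + n)) (u (1 + n)) (u (2 + n))) ⟩
    (S - u (1 + n) * g (1 + n)) ⊕ (u (1 + n) * g (2 + n) - u (2 + n) * g (2 + n))
      ≈⟨ solve 4 (λ s a b c → (s :+ a) :+ (b :+ c) := (s :+ (b :+ a)) :+ c) refl _ _ _ _ ⟩
    (S ⊕ (u (1 + n) * g (2 + n) - u (1 + n) * g (1 + n))) - u (2 + n) * g (2 + n)
      ≈⟨ +-congʳ (+-congˡ (x[y-z]≈xy-xz (u (1 + n)) (g (2 + n)) (g (1 + n)))) ⟨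
    (S ⊕ u (1 + n) * (g (2 + n) - g (1 + n))) - u (2 + n) * g (2 + n) ∎
    where
    S = ∑[ k ≤ n ] u k * (g (suc k) - g k)

  ι≡·1# : ∀ n → ι R n ≡ n · 1#
  ι≡·1# zero    = ≡.refl
  ι≡·1# (suc n) = cong (1# ⊕_) (ι≡·1# n)

  ι-homo-+ : ∀ m n → ι R (m + n) ≈ ι R m ⊕ ι R n
  ι-homo-+ m n = begin
    ι R (m + n)      ≡⟨ ι≡·1# (m + n) ⟩
    (m + n) · 1#     ≈⟨ ×-homo-+ 1# m n ⟩
    m · 1# ⊕ n · 1#  ≡⟨ cong₂ _⊕_ (ι≡·1# m) (ι≡·1# n) ⟨
    ι R m ⊕ ι R n    ∎

  ι-homo-* : ∀ m n → ι R (m ℕ.* n) ≈ ι R m * ι R n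
  ι-homo-* m n = begin
    ι R (m ℕ.* n)    ≡⟨ ι≡·1# (m ℕ.* n) ⟩
    (m ℕ.* n) · 1#   ≈⟨ ×1-homo-* m n ⟩
    m · 1# * n · 1#  ≡⟨ cong₂ _*_ (ι≡·1# m) (ι≡·1# n) ⟨
    ι R m * ι R n    ∎

  ι-C-vanishes : ∀ {n k} → n < k → ι R (n C k) ≈ 0#
  ι-C-vanishes n<k = reflexive (cong (ι R) (k>n⇒nCk≡0 n<k))

  ι-pascal : ∀ n k → ι R (suc n C suc k) ≈ ι R (n C k) ⊕ ι R (n C suc k)
  ι-pascal n k = trans (reflexive (cong (ι R) (≡.sym (nCk+nC[k+1]≡[n+1]C[k+1] n k))))
                       (ι-homo-+ (n C k) (n C suc k))

  ι-C-difference : ∀ n k → ι R (suc n C suc k) - ι R (n C suc k) ≈ ι R (n C k)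
  ι-C-difference n k = trans (+-congʳ (trans (ι-pascal n k) (+-comm _ _))) (xyx⁻¹≈y _ _)

  ι-C-absorb : ∀ n k → ι R n * ι R (n C k) ≈ ι R (suc k) * ι R (n C suc k) ⊕ ι R k * ι R (n C k)
  ι-C-absorb n k = begin
    ι R n * ι R (n C k)
      ≈⟨ ι-homo-* n (n C k) ⟨
    ι R (n ℕ.* (n C k))
      ≡⟨ cong (ι R) (n*nCk≡[1+k]*nC[1+k]+k*nCk n k) ⟩
    ι R (suc k ℕ.* (n C suc k) + k ℕ.* (n C k))
      ≈⟨ ι-homo-+ (suc k ℕ.* (n C suc k)) (k ℕ.* (n C k)) ⟩
    ι R (suc k ℕ.* (n C suc k)) ⊕ ι R (k ℕ.* (n C k))
      ≈⟨ +-cong (ι-homo-* (suc k) (n C suc k)) (ι-homo-* k (n C k)) ⟩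
    ι R (suc k) * ι R (n C suc k) ⊕ ι R k * ι R (n C k) ∎

  shifted-ι-C-absorb : ∀ r a k j →
    ((r ⊕ ι R k) * a) * ι R (k C j) ≈ (r ⊕ ι R j) * (a * ι R (k C j)) ⊕ ι R (suc j) * (a * ι R (k C suc j))
  shifted-ι-C-absorb r a k j = begin
    ((r ⊕ ι R k) * a) * ι R (k C j)
      ≈⟨ solve 4 (λ r i a c₀ → ((r :+ i) :* a) :* c₀ := a :* (r :* c₀ :+ i :* c₀)) refl r (ι R k) a (ι R (k C j)) ⟩
    a * (r * ι R (k C j) ⊕ ι R k * ι R (k C j))
      ≈⟨ *-congˡ (+-congˡ (ι-C-absorb k j)) ⟩
    a * (r * ι R (k C j) ⊕ (ι R (suc j) * ι R (k C suc j) ⊕ ι R j * ι R (k C j)))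
      ≈⟨ solve 6 (λ a r c₀ m c₁ i → a :* (r :* c₀ :+ (m :* c₁ :+ i :* c₀)) := (r :+ i) :* (a :* c₀) :+ m :* (a :* c₁))
                 refl a r (ι R (k C j)) (ι R (suc j)) (ι R (k C suc j)) (ι R j) ⟩
    (r ⊕ ι R j) * (a * ι R (k C j)) ⊕ ι R (suc j) * (a * ι R (k C suc j)) ∎

  pow-1# : ∀ n → pow R 1# n ≈ 1#
  pow-1# zero    = refl
  pow-1# (suc n) = trans (*-identityˡ _) (pow-1# n)

  -- rS2 R r n k unfolds to binomialConv r n (λ j → ι R (S2 j k)).
  binomialConv : Carrier → ℕ → (ℕ → Carrier) → Carrier
  binomialConv x n g = ∑[ j ≤ n ] ι R (n C j) * (g j * pow R x (n ∸ j))

  module _ (x : Carrier) where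

    binomialConv-cong : ∀ n {g h : ℕ → Carrier} → (∀ {j} → j ≤ n → g j ≈ h j) →
                        binomialConv x n g ≈ binomialConv x n h
    binomialConv-cong n g≈h = ∑-cong n (λ j≤n → *-congˡ (*-congʳ (g≈h j≤n)))

    binomialConv-vanishes : ∀ n {g : ℕ → Carrier} → (∀ {j} → j ≤ n → g j ≈ 0#) → binomialConv x n g ≈ 0#
    binomialConv-vanishes n g≈0 =
      ∑-zero n (λ j≤n → trans (*-congˡ (trans (*-congʳ (g≈0 j≤n)) (zeroˡ _))) (zeroʳ _))

    binomialConv-⊕ : ∀ n (g h : ℕ → Carrier) →
                     binomialConv x n (λ j → g j ⊕ h j) ≈ binomialConv x n g ⊕ binomialConv x n h
    binomialConv-⊕ n g h =
      trans (∑-cong n (λ _ → trans (*-congˡ (distribʳ _ _ _)) (distribˡ _ _ _))) (∑-distrib-⊕ n _ _)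

    binomialConv-* : ∀ n a (g : ℕ → Carrier) → binomialConv x n (λ j → a * g j) ≈ a * binomialConv x n g
    binomialConv-* n a g =
      trans (∑-cong n (λ {j} _ → swap (ι R (n C j)) (g j) (pow R x (n ∸ j)))) (sym (*-distribˡ-∑ n a _))
      where
      swap : ∀ c y p → c * ((a * y) * p) ≈ a * (c * (y * p))
      swap = solve 4 (λ a c y p → c :* ((a :* y) :* p) := a :* (c :* (y :* p))) refl a

    binomialConv-suc : ∀ n (g : ℕ → Carrier) →
                       binomialConv x (suc n) g ≈ x * binomialConv x n g ⊕ binomialConv x n (g ∘ suc)
    binomialConv-suc n g = begin
      binomialConv x (suc n) g
        ≈⟨ ∑-suc n _ ⟩
      F 0 ⊕ ∑[ j ≤ n ] ι R (suc n C suc j) * (g (suc j) * pow R x (n ∸ j))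
        ≈⟨ +-congˡ (∑-cong n (λ {j} _ → trans (*-congʳ (ι-pascal n j)) (distribʳ _ _ _))) ⟩
      F 0 ⊕ ∑[ j ≤ n ] (ι R (n C j) * (g (suc j) * pow R x (n ∸ j)) ⊕ F (suc j))
        ≈⟨ +-congˡ (∑-distrib-⊕ n _ _) ⟩
      F 0 ⊕ (binomialConv x n (g ∘ suc) ⊕ ∑[ j ≤ n ] F (suc j))
        ≈⟨ x+[y+z]≈y+[x+z] _ _ _ ⟩
      binomialConv x n (g ∘ suc) ⊕ (F 0 ⊕ ∑[ j ≤ n ] F (suc j))
        ≈⟨ +-congˡ (∑-suc n F) ⟨
      binomialConv x n (g ∘ suc) ⊕ ∑ (suc n) F
        ≈⟨ +-congˡ x*binomialConv≈∑F ⟨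
      binomialConv x n (g ∘ suc) ⊕ x * binomialConv x n g
        ≈⟨ +-comm _ _ ⟩
      x * binomialConv x n g ⊕ binomialConv x n (g ∘ suc) ∎
      where
      F : ℕ → Carrier
      F j = ι R (n C j) * (g j * pow R x (suc n ∸ j))

      x*binomialConv≈∑F : x * binomialConv x n g ≈ ∑ (suc n) F
      x*binomialConv≈∑F = begin
        x * binomialConv x n g
          ≈⟨ *-distribˡ-∑ n x _ ⟩
        ∑[ j ≤ n ] x * (ι R (n C j) * (g j * pow R x (n ∸ j)))
          ≈⟨ ∑-cong n (λ j≤n → trans (x*[y*z]≈y*[x*z] _ _ _) (*-congˡ (trans (x*[y*z]≈y*[x*z] _ _ _)
                 (*-congˡ (reflexive (cong (pow R x) (≡.sym (ℕₚ.+-∸-assoc 1 j≤n)))))))) ⟩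
        ∑ n F
          ≈⟨ ∑-pad F (ℕₚ.n≤1+n n) (λ n<j → trans (*-congʳ (ι-C-vanishes n<j)) (zeroˡ _)) ⟨
        ∑ (suc n) F ∎

  binomial : ∀ x y n → binomialConv x n (pow R y) ≈ pow R (y ⊕ x) n
  binomial x y zero    = trans (*-cong (+-identityʳ 1#) (*-identityˡ 1#)) (*-identityˡ 1#)
  binomial x y (suc n) = begin
    binomialConv x (suc n) (pow R y)
      ≈⟨ binomialConv-suc x n (pow R y) ⟩
    x * binomialConv x n (pow R y) ⊕ binomialConv x n (λ j → y * pow R y j)
      ≈⟨ +-comm _ _ ⟩
    binomialConv x n (λ j → y * pow R y j) ⊕ x * binomialConv x n (pow R y)
      ≈⟨ +-congʳ (binomialConv-* x n y (pow R y)) ⟩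
    y * binomialConv x n (pow R y) ⊕ x * binomialConv x n (pow R y)
      ≈⟨ distribʳ _ y x ⟨
    (y ⊕ x) * binomialConv x n (pow R y)
      ≈⟨ *-congˡ (binomial x y n) ⟩
    (y ⊕ x) * pow R (y ⊕ x) n ∎

  pow-⊕1#-expansion : ∀ y {k n} → k ≤ n → pow R (y ⊕ 1#) k ≈ ∑[ m ≤ n ] ι R (k C m) * pow R y m
  pow-⊕1#-expansion y {k} {n} k≤n = begin
    pow R (y ⊕ 1#) k
      ≈⟨ binomial 1# y k ⟨
    ∑[ m ≤ k ] ι R (k C m) * (pow R y m * pow R 1# (k ∸ m))
      ≈⟨ ∑-cong k (λ {m} _ → *-congˡ (trans (*-congˡ (pow-1# (k ∸ m))) (*-identityʳ _))) ⟩
    ∑[ m ≤ k ] ι R (k C m) * pow R y m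
      ≈⟨ ∑-pad _ k≤n (λ k<m → trans (*-congʳ (ι-C-vanishes k<m)) (zeroˡ _)) ⟨
    ∑[ m ≤ n ] ι R (k C m) * pow R y m ∎

  ∑*pow-change-of-basis : ∀ n y (a b : ℕ → Carrier) → (∀ m → ∑[ k ≤ n ] a k * ι R (k C m) ≈ b m) →
                          ∑[ k ≤ n ] a k * pow R (y ⊕ 1#) k ≈ ∑[ m ≤ n ] b m * pow R y m
  ∑*pow-change-of-basis n y a b ∑aC≈b = begin
    ∑[ k ≤ n ] a k * pow R (y ⊕ 1#) k
      ≈⟨ ∑-cong n (λ k≤n → *-congˡ (pow-⊕1#-expansion y k≤n)) ⟩
    ∑[ k ≤ n ] a k * (∑[ m ≤ n ] ι R (k C m) * pow R y m)
      ≈⟨ ∑-cong n (λ {k} _ → *-distribˡ-∑ n (a k) _) ⟩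
    ∑[ k ≤ n ] ∑[ m ≤ n ] a k * (ι R (k C m) * pow R y m)
      ≈⟨ ∑-comm n n _ ⟩
    ∑[ m ≤ n ] ∑[ k ≤ n ] a k * (ι R (k C m) * pow R y m)
      ≈⟨ ∑-cong n (λ {m} _ → trans (∑-cong n (λ _ → sym (*-assoc _ _ _))) (sym (*-distribʳ-∑ n (pow R y m) _))) ⟩
    ∑[ m ≤ n ] (∑[ k ≤ n ] a k * ι R (k C m)) * pow R y m
      ≈⟨ ∑-cong n (λ {m} _ → *-congʳ (∑aC≈b m)) ⟩
    ∑[ m ≤ n ] b m * pow R y m ∎

  module _ (r : Carrier) where

    rS2-suc-zero : ∀ n → rS2 R r (suc n) 0 ≈ r * rS2 R r n 0
    rS2-suc-zero n =
      trans (binomialConv-suc r n _) (trans (+-congˡ (binomialConv-vanishes r n (λ _ → refl))) (+-identityʳ _))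

    rS2-suc-suc : ∀ n k →
      rS2 R r (suc n) (suc k) ≈ r * rS2 R r n (suc k) ⊕ (rS2 R r n k ⊕ ι R (suc k) * rS2 R r n (suc k))
    rS2-suc-suc n k = trans (binomialConv-suc r n _) (+-congˡ (begin
      binomialConv r n (λ j → ι R (S2 (suc j) (suc k)))
        ≈⟨ binomialConv-cong r n (λ {j} _ →
             trans (ι-homo-+ (S2 j k) _) (+-congˡ (ι-homo-* (suc k) (S2 j (suc k))))) ⟩
      binomialConv r n (λ j → ι R (S2 j k) ⊕ ι R (suc k) * ι R (S2 j (suc k)))
        ≈⟨ binomialConv-⊕ r n _ _ ⟩
      rS2 R r n k ⊕ binomialConv r n (λ j → ι R (suc k) * ι R (S2 j (suc k)))
        ≈⟨ +-congˡ (binomialConv-* r n (ι R (suc k)) _) ⟩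
      rS2 R r n k ⊕ ι R (suc k) * rS2 R r n (suc k) ∎))

    rS2-vanishes : ∀ {n k} → n < k → rS2 R r n k ≈ 0#
    rS2-vanishes {n} n<k =
      binomialConv-vanishes r n (λ j≤n → reflexive (cong (ι R) (S2-vanishes (ℕₚ.≤-<-trans j≤n n<k))))

    S2*rising-suc : ∀ n j →
      (r ⊕ ι R j) * (ι R (S2 n j) * rising R r j) ⊕ ι R (suc j) * (ι R (S2 n (suc j)) * rising R r (suc j))
        ≈ ι R (S2 (suc n) (suc j)) * rising R r (suc j)
    S2*rising-suc n j = begin
      (r ⊕ ι R j) * (ι R (S2 n j) * ρ) ⊕ ι R (suc j) * (ι R (S2 n (suc j)) * (ρ * (r ⊕ ι R j)))
        ≈⟨ solve 6 (λ r i s₀ ρ m s₁ → (r :+ i) :* (s₀ :* ρ) :+ m :* (s₁ :* (ρ :* (r :+ i)))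
                                       := (s₀ :+ m :* s₁) :* (ρ :* (r :+ i)))
                   refl r (ι R j) (ι R (S2 n j)) ρ (ι R (suc j)) (ι R (S2 n (suc j))) ⟩
      (ι R (S2 n j) ⊕ ι R (suc j) * ι R (S2 n (suc j))) * rising R r (suc j)
        ≈⟨ *-congʳ (trans (ι-homo-+ (S2 n j) _) (+-congˡ (ι-homo-* (suc j) (S2 n (suc j))))) ⟨
      ι R (S2 (suc n) (suc j)) * rising R r (suc j) ∎
      where
      ρ = rising R r j

    coeff : ℕ → ℕ → Carrier
    coeff n k = pow R (- 1#) (n + k) * (rS2 R r n k * rising R r k)

    coeff-0-0 : coeff 0 0 ≈ 1#
    coeff-0-0 = begin
      1# * ((ι R 1 * (ι R 1 * 1#)) * 1#)  ≈⟨ *-identityˡ _ ⟩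
      (ι R 1 * (ι R 1 * 1#)) * 1#         ≈⟨ *-identityʳ _ ⟩
      ι R 1 * (ι R 1 * 1#)                ≈⟨ *-congˡ (*-identityʳ _) ⟩
      ι R 1 * ι R 1                       ≈⟨ *-cong (+-identityʳ 1#) (+-identityʳ 1#) ⟩
      1# * 1#                             ≈⟨ *-identityˡ 1# ⟩
      1#                                  ∎

    coeff-vanishes : ∀ {n k} → n < k → coeff n k ≈ 0#
    coeff-vanishes n<k = trans (*-congˡ (trans (*-congʳ (rS2-vanishes n<k)) (zeroˡ _))) (zeroʳ _)

    coeff-suc : ∀ n k → coeff (suc n) k ≈ ∇ (λ j → (r ⊕ ι R j) * coeff n j) k
    coeff-suc n zero = begin
      pow R (- 1#) (suc (n + 0)) * (rS2 R r (suc n) 0 * 1#)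
        ≈⟨ *-cong (-1*x≈-x s) (*-congʳ (rS2-suc-zero n)) ⟩
      - s * ((r * P) * 1#)
        ≈⟨ -‿distribˡ-* s _ ⟨
      - (s * ((r * P) * 1#))
        ≈⟨ -‿cong (solve 4 (λ s r p e → s :* ((r :* p) :* e) := (r :+ con 0) :* (s :* (p :* e))) refl s r P 1#) ⟩
      - ((r ⊕ 0#) * coeff n 0) ∎
      where
      s = pow R (- 1#) (n + 0)
      P = rS2 R r n 0
    coeff-suc n (suc k) = begin
      pow R (- 1#) (suc (n + suc k)) * (rS2 R r (suc n) (suc k) * (ρ * (r ⊕ i)))
        ≈⟨ *-cong (trans (-1*x≈-x _) (trans (-‿cong σ≈-s) (-‿involutive s))) (*-congʳ (rS2-suc-suc n k)) ⟩
      s * ((r * P₁ ⊕ (P₀ ⊕ m * P₁)) * (ρ * (r ⊕ i)))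
        ≈⟨ solve 7 (λ s r i m ρ P₀ P₁ → s :* ((r :* P₁ :+ (P₀ :+ m :* P₁)) :* (ρ :* (r :+ i)))
                       := (r :+ i) :* (s :* (P₀ :* ρ)) :+ (r :+ m) :* (s :* (P₁ :* (ρ :* (r :+ i)))))
                   refl s r i m ρ P₀ P₁ ⟩
      (r ⊕ i) * coeff n k ⊕ (r ⊕ m) * (s * Y)
        ≈⟨ +-congˡ (begin
             (r ⊕ m) * (s * Y)               ≈⟨ -‿involutive _ ⟨
             - - ((r ⊕ m) * (s * Y))         ≈⟨ -‿cong (-‿distribʳ-* (r ⊕ m) (s * Y)) ⟩
             - ((r ⊕ m) * - (s * Y))         ≈⟨ -‿cong (*-congˡ (trans (-‿distribˡ-* s Y) (*-congʳ (sym σ≈-s)))) ⟩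
             - ((r ⊕ m) * coeff n (suc k))   ∎) ⟩
      (r ⊕ i) * coeff n k - (r ⊕ m) * coeff n (suc k) ∎
      where
      s = pow R (- 1#) (n + k)
      i = ι R k
      m = ι R (suc k)
      ρ = rising R r k
      P₀ = rS2 R r n k
      P₁ = rS2 R r n (suc k)
      Y = P₁ * (ρ * (r ⊕ i))
      σ≈-s : pow R (- 1#) (n + suc k) ≈ - s
      σ≈-s = trans (reflexive (cong (pow R (- 1#)) (ℕₚ.+-suc n k))) (-1*x≈-x s)

    ∑coeff-suc-by-parts : ∀ n (g : ℕ → Carrier) →
      ∑[ k ≤ suc n ] coeff (suc n) k * g k ≈ ∑[ k ≤ n ] ((r ⊕ ι R k) * coeff n k) * (g (suc k) - g k)
    ∑coeff-suc-by-parts n g = begin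
      ∑[ k ≤ suc n ] coeff (suc n) k * g k
        ≈⟨ ∑-cong (suc n) (λ {k} _ → *-congʳ (coeff-suc n k)) ⟩
      ∑[ k ≤ suc n ] ∇ u k * g k
        ≈⟨ ∑-∇-by-parts n u g ⟩
      S - u (suc n) * g (suc n)
        ≈⟨ +-congˡ (trans (-‿cong (trans (*-congʳ u[1+n]≈0) (zeroˡ _))) -0#≈0#) ⟩
      S ⊕ 0#
        ≈⟨ +-identityʳ S ⟩
      S ∎
      where
      u : ℕ → Carrier
      u j = (r ⊕ ι R j) * coeff n j
      S = ∑[ k ≤ n ] u k * (g (suc k) - g k)
      u[1+n]≈0 : u (suc n) ≈ 0#
      u[1+n]≈0 = trans (*-congˡ (coeff-vanishes (ℕₚ.n<1+n n))) (zeroʳ _)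

    ∑coeff*C≈S2*rising : ∀ n m → ∑[ k ≤ n ] coeff n k * ι R (k C m) ≈ ι R (S2 n m) * rising R r m
    ∑coeff*C≈S2*rising zero    zero    = trans (*-congʳ coeff-0-0) (*-comm 1# _)
    ∑coeff*C≈S2*rising zero    (suc m) = trans (zeroʳ _) (sym (zeroˡ _))
    ∑coeff*C≈S2*rising (suc n) zero    = begin
      ∑[ k ≤ suc n ] coeff (suc n) k * ι R (k C 0)
        ≈⟨ ∑coeff-suc-by-parts n (λ k → ι R (k C 0)) ⟩
      ∑[ k ≤ n ] ((r ⊕ ι R k) * coeff n k) * (ι R 1 - ι R 1)
        ≈⟨ ∑-zero n (λ _ → trans (*-congˡ (-‿inverseʳ _)) (zeroʳ _)) ⟩
      0#
        ≈⟨ zeroˡ 1# ⟨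
      0# * 1# ∎
    ∑coeff*C≈S2*rising (suc n) (suc j) = begin
      ∑[ k ≤ suc n ] coeff (suc n) k * ι R (k C suc j)
        ≈⟨ ∑coeff-suc-by-parts n (λ k → ι R (k C suc j)) ⟩
      ∑[ k ≤ n ] ((r ⊕ ι R k) * coeff n k) * (ι R (suc k C suc j) - ι R (k C suc j))
        ≈⟨ ∑-cong n (λ {k} _ → trans (*-congˡ (ι-C-difference k j)) (shifted-ι-C-absorb r (coeff n k) k j)) ⟩
      ∑[ k ≤ n ] ((r ⊕ ι R j) * (coeff n k * ι R (k C j)) ⊕ ι R (suc j) * (coeff n k * ι R (k C suc j)))
        ≈⟨ trans (∑-distrib-⊕ n _ _) (sym (+-cong (*-distribˡ-∑ n _ _) (*-distribˡ-∑ n _ _))) ⟩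
      (r ⊕ ι R j) * (∑[ k ≤ n ] coeff n k * ι R (k C j))
        ⊕ ι R (suc j) * (∑[ k ≤ n ] coeff n k * ι R (k C suc j))
        ≈⟨ +-cong (*-congˡ (∑coeff*C≈S2*rising n j)) (*-congˡ (∑coeff*C≈S2*rising n (suc j))) ⟩
      (r ⊕ ι R j) * (ι R (S2 n j) * rising R r j) ⊕ ι R (suc j) * (ι R (S2 n (suc j)) * rising R r (suc j))
        ≈⟨ S2*rising-suc n j ⟩
      ι R (S2 (suc n) (suc j)) * rising R r (suc j) ∎

    w≈∑-powers-of-y⊕1# : ∀ n y →
      w R r n y ≈ ∑[ k ≤ n ] rS2 R r n k * (rising R r k * (pow R (- 1#) (n + k) * pow R (y ⊕ 1#) k))
    w≈∑-powers-of-y⊕1# n y = sym (begin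
      ∑[ k ≤ n ] rS2 R r n k * (rising R r k * (pow R (- 1#) (n + k) * pow R (y ⊕ 1#) k))
        ≈⟨ ∑-cong n (λ _ → solve 4 (λ p ρ s q → p :* (ρ :* (s :* q)) := (s :* (p :* ρ)) :* q) refl _ _ _ _) ⟩
      ∑[ k ≤ n ] coeff n k * pow R (y ⊕ 1#) k
        ≈⟨ ∑*pow-change-of-basis n y (coeff n) _ (∑coeff*C≈S2*rising n) ⟩
      ∑[ m ≤ n ] (ι R (S2 n m) * rising R r m) * pow R y m
        ≈⟨ ∑-cong n (λ _ → *-assoc _ _ _) ⟩
      w R r n y ∎)

theorem3p3 : {c ℓ : Level} (R : CommutativeRing c ℓ) →
    let open CommutativeRing R renaming (_+_ to _⊕_) in
    (r : Carrier) (n : ℕ) →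
      ((y : Carrier) →
        w R r n y ≈ sumTo R n (λ k → rS2 R r n k * (rising R r k * (pow R (- 1#) (n + k) * pow R (y ⊕ 1#) k))))
      × (w R r n 1# ≈ sumTo R n (λ k → rS2 R r n k * (rising R r k * (pow R (- 1#) (n + k) * pow R (1# ⊕ 1#) k))))
theorem3p3 R r n = w≈∑-powers-of-y⊕1# R r n , w≈∑-powers-of-y⊕1# R r n (CommutativeRing.1# R)
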